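{- For all $f\in\mathbb{Z}_n^{\mathbb{Z}_n}$, \[ 1\le\min_{\sigma\in S_n}\left|\left\{|\sigma f\sigma^{(-1)}(i)-i|:i\in\mathbb{Z}_n\right\}\right|\le 1+\rho_f+\begin{cases}1 & \text{if there is } i\in\mathbb{Z}_n \text{ with } f(i)=i,\\ 0&\text{otherwise,}\end{cases} \] where $\rho_f$ denotes the minimum number of non-loop edge deletions required in $G_f$ to obtain a spanning subgraph which is a union of disjoint paths possibly having loop edges.
   Context: $\mathbb{Z}_n:=\{0,\dots,n-1\}$; $\mathbb{Z}_n^{\mathbb{Z}_n}$ is the set of maps $\mathbb{Z}_n\to\mathbb{Z}_n$; $S_n$ is the symmetric group on $\mathbb{Z}_n$. $G_f$ is the functional directed graph with vertex set $\mathbb{Z}_n$ and directed edges $(i,f(i))$, $i\in\mathbb{Z}_n$; edges $(i,i)$ are loop edges. -}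

module Defs where

open import Data.Nat using (ℕ; zero; suc; _+_; _≤_; ∣_-_∣)
import Data.Nat.Properties as ℕₚ
open import Data.Fin using (Fin; toℕ)
open import Data.Fin.Properties using (any?) renaming (_≟_ to _≟ᶠ_)
open import Data.Fin.Subset using (Subset; _∈_; _∉_; ∣_∣)
open import Data.Fin.Permutation using (Permutation′; _⟨$⟩ʳ_; _⟨$⟩ˡ_)
open import Data.List using (List; map; length; deduplicate)
open import Data.List.Base using () renaming (allFin to allFinL)
open import Data.Product using (Σ; ∃; _×_)
open import Relation.Nullary using (¬_; Dec; yes; no)
open import Relation.Binary.PropositionalEquality using (_≡_; _≢_)

Map : ℕ → Set
Map n = Fin n → Fin n

conj : ∀ {n} → Permutation′ n → Map n → Map n
conj σ f i = σ ⟨$⟩ʳ f (σ ⟨$⟩ˡ i)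

numDiffs : ∀ {n} → Map n → ℕ
numDiffs {n} g =
  length (deduplicate ℕₚ._≟_ (map (λ i → ∣ toℕ (g i) - toℕ i ∣) (allFinL n)))

IsMinimum : (ℕ → Set) → ℕ → Set
IsMinimum P m = P m × (∀ k → P k → m ≤ k)

-- Edges of G_f: (i , f i) for each i; D ⊆ Z_n is the set of (tails of) deleted edges.
-- The edge out of i is a kept non-loop edge if it is not deleted and not a loop.
Kept : ∀ {n} → Map n → Subset n → Fin n → Set
Kept f D i = (i ∉ D) × (f i ≢ i)

data Walk {n} (f : Map n) (D : Subset n) : ℕ → Fin n → Fin n → Set where
  here : ∀ {i} → Walk f D zero i i
  step : ∀ {k i j} → Kept f D i → Walk f D k (f i) j → Walk f D (suc k) i j

-- D is an admissible deletion set: only non-loop edges are deleted, and the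
-- remaining spanning subgraph (kept non-loop edges plus all loop edges) is a
-- disjoint union of directed paths possibly having loop edges, i.e. every
-- vertex has at most one incoming kept non-loop edge (out-degree ≤ 1 is automatic)
-- and there is no directed cycle of kept non-loop edges.
PathDeletion : ∀ {n} → Map n → Subset n → Set
PathDeletion {n} f D =
  (∀ i → i ∈ D → f i ≢ i)
  × (∀ i j → Kept f D i → Kept f D j → f i ≡ f j → i ≡ j)
  × (∀ k (i : Fin n) → ¬ Walk f D (suc k) i i)

IsRho : ∀ {n} → Map n → ℕ → Set
IsRho f ρ = IsMinimum (λ k → Σ _ λ D → PathDeletion f D × ∣ D ∣ ≡ k) ρ

fixedIndicator : ∀ {n} → Map n → ℕ
fixedIndicator f with any? (λ i → f i ≟ᶠ i)
... | yes _ = 1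
... | no _ = 0

IsMinDiffs : ∀ {n} → Map n → ℕ → Set
IsMinDiffs {n} f μ = IsMinimum (λ k → ∃ λ (σ : Permutation′ n) → numDiffs (conj σ f) ≡ k) μ

{-# OPTIONS --safe #-}
module Submission where

open import Defs
open import Data.Fin using (Fin; zero; suc; toℕ; fromℕ<; combine; punchOut)
open import Data.Fin.Permutation using (Permutation′; permutation; _⟨$⟩ʳ_; _⟨$⟩ˡ_; inverseʳ)
open import Data.Fin.Properties
  using (any?; pigeonhole; injective⇒≤; punchOut-injective; toℕ-injective; toℕ-fromℕ<;
         fromℕ<-injective; toℕ-combine; combine-injective; 0≢1+n; suc-injective)
  renaming (_≟_ to _≟ᶠ_)
open import Data.Fin.Subset using (Subset; inside; outside; _∈_; ∣_∣)
open import Data.Fin.Subset.Properties using (_∈?_)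
open import Data.List using (List; []; _∷_; _++_; length; lookup; map; replicate; deduplicate)
open import Data.List.Base using () renaming (allFin to allFinL)
open import Data.List.Membership.Propositional using () renaming (_∈_ to _∈ₗ_)
open import Data.List.Membership.Propositional.Properties
  using (∈-lookup; ∈-map⁻; ∈-deduplicate⁻; ∈-++⁺ˡ; ∈-++⁺ʳ)
open import Data.List.Properties using (length-++; length-replicate)
open import Data.List.Relation.Unary.All as All using ()
open import Data.List.Relation.Unary.AllPairs using (_∷_)
open import Data.List.Relation.Unary.Any using (here; there; index)
open import Data.List.Relation.Unary.Any.Properties using (lookup-index)
open import Data.List.Relation.Unary.Unique.Propositional using (Unique)
open import Data.Nat using (ℕ; zero; suc; pred; _+_; _*_; _≤_; _<_; z≤n; s≤s; s≤s⁻¹; s<s⁻¹; _<?_; ∣_-_∣)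
import Data.Nat.Properties as ℕₚ
open import Data.List.Relation.Unary.Unique.DecPropositional.Properties ℕₚ._≟_ using (deduplicate-!)
open import Data.Product using (Σ; ∃; _×_; _,_; proj₁; proj₂; map₂)
open import Data.Product.Properties using (×-≡,≡→≡)
open import Data.Vec using ([]; _∷_; here; there)
open import Function using (_∘_; case_of_; Injective)
open import Relation.Binary using (tri<; tri≈; tri>)
open import Relation.Binary.PropositionalEquality
open import Relation.Nullary using (¬_; Dec; yes; no; ¬?; _×-dec_; contradiction)

-- Delete an optimal edge set D; what is left of G_f is a disjoint union of paths. Following the
-- kept edges from v reaches the end of v's path in fewer than n steps (a longer walk would repeat
-- a vertex and close a cycle), and ranking the vertices by the key (end of path, distance to it)
-- gives a permutation σ under which every kept edge goes from label ℓ + 1 to label ℓ. Hence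
-- σ f σ⁻¹ moves a point by 1 across a kept edge, by 0 at a loop, and by one of at most ∣ D ∣
-- values across a deleted edge.

module _ {A : Set} where

  Unique-lookup-injective : ∀ {xs : List A} → Unique xs → Injective _≡_ _≡_ (lookup xs)
  Unique-lookup-injective {_ ∷ _} _ {zero} {zero} _ = refl
  Unique-lookup-injective {_ ∷ _} (x∉xs ∷ _) {zero} {suc j} eq =
    contradiction eq (All.lookup x∉xs (∈-lookup j))
  Unique-lookup-injective {_ ∷ _} (x∉xs ∷ _) {suc i} {zero} eq =
    contradiction (sym eq) (All.lookup x∉xs (∈-lookup i))
  Unique-lookup-injective {_ ∷ _} (_ ∷ unique) {suc i} {suc j} eq =
    cong suc (Unique-lookup-injective unique eq)

  Unique-⊆⇒length≤ : ∀ {xs ys : List A} → Unique xs → (∀ {z} → z ∈ₗ xs → z ∈ₗ ys) →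
                     length xs ≤ length ys
  Unique-⊆⇒length≤ {xs} {ys} unique xs⊆ys = injective⇒≤ position-injective
    where
    position : Fin (length xs) → Fin (length ys)
    position i = index (xs⊆ys (∈-lookup i))

    position-injective : Injective _≡_ _≡_ position
    position-injective {i} {j} eq = Unique-lookup-injective unique (begin
      lookup xs i               ≡⟨ lookup-index (xs⊆ys (∈-lookup i)) ⟩
      lookup ys (position i)    ≡⟨ cong (lookup ys) eq ⟩
      lookup ys (position j)    ≡⟨ lookup-index (xs⊆ys (∈-lookup j)) ⟨
      lookup xs j               ∎)
      where open ≡-Reasoning

  subsetImage : ∀ {n} → Subset n → (Fin n → A) → List A
  subsetImage []            h = []
  subsetImage (inside  ∷ p) h = h zero ∷ subsetImage p (h ∘ suc)
  subsetImage (outside ∷ p) h = subsetImage p (h ∘ suc)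

  length-subsetImage : ∀ {n} (p : Subset n) h → length (subsetImage p h) ≡ ∣ p ∣
  length-subsetImage []            h = refl
  length-subsetImage (inside  ∷ p) h = cong suc (length-subsetImage p (h ∘ suc))
  length-subsetImage (outside ∷ p) h = length-subsetImage p (h ∘ suc)

  ∈-subsetImage : ∀ {n} {p : Subset n} h {i} → i ∈ p → h i ∈ₗ subsetImage p h
  ∈-subsetImage {p = inside  ∷ p} h {zero}  _ = here refl
  ∈-subsetImage {p = inside  ∷ p} h {suc i} (there i∈p) = there (∈-subsetImage (h ∘ suc) i∈p)
  ∈-subsetImage {p = outside ∷ p} h {suc i} (there i∈p) = ∈-subsetImage (h ∘ suc) i∈p

length-deduplicate≤ : ∀ xs {ys : List ℕ} → (∀ {z} → z ∈ₗ xs → z ∈ₗ ys) →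
                      length (deduplicate ℕₚ._≟_ xs) ≤ length ys
length-deduplicate≤ xs xs⊆ys =
  Unique-⊆⇒length≤ (deduplicate-! xs) (xs⊆ys ∘ ∈-deduplicate⁻ ℕₚ._≟_ xs)

injective⇒surjective : ∀ {n} {g : Fin n → Fin n} → Injective _≡_ _≡_ g → ∀ j → ∃ λ i → g i ≡ j
injective⇒surjective {suc m} {g} g-injective j with any? (λ i → g i ≟ᶠ j)
... | yes hit  = hit
... | no  miss = contradiction (injective⇒≤ g′-injective) ℕₚ.1+n≰n
  where
  j≢g : ∀ i → j ≢ g i
  j≢g i j≡gi = miss (i , sym j≡gi)

  g′ : Fin (suc m) → Fin m
  g′ i = punchOut (j≢g i)

  g′-injective : Injective _≡_ _≡_ g′
  g′-injective = g-injective ∘ punchOut-injective (j≢g _) (j≢g _)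

injective⇒permutation : ∀ {n} {g : Fin n → Fin n} → Injective _≡_ _≡_ g →
                        Σ (Permutation′ n) λ σ → ∀ i → σ ⟨$⟩ʳ i ≡ g i
injective⇒permutation {g = g} g-injective =
  permutation g (proj₁ ∘ surj) (proj₂ ∘ surj) (λ i → g-injective (proj₂ (surj (g i)))) ,
  λ _ → refl
  where surj = injective⇒surjective g-injective

rank : ∀ {n} → (Fin n → ℕ) → ℕ → ℕ
rank {zero}  k x = 0
rank {suc n} k x with k zero <? x
... | yes _ = suc (rank (k ∘ suc) x)
... | no  _ = rank (k ∘ suc) x

rank≤n : ∀ {n} (k : Fin n → ℕ) x → rank k x ≤ n
rank≤n {zero}  k x = z≤n
rank≤n {suc n} k x with k zero <? x
... | yes _ = s≤s (rank≤n (k ∘ suc) x)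
... | no  _ = ℕₚ.m≤n⇒m≤1+n (rank≤n (k ∘ suc) x)

rank-mono : ∀ {n} (k : Fin n → ℕ) {x y} → x ≤ y → rank k x ≤ rank k y
rank-mono {zero}  k x≤y = z≤n
rank-mono {suc n} k {x} {y} x≤y with k zero <? x | k zero <? y
... | yes _  | yes _  = s≤s (rank-mono (k ∘ suc) x≤y)
... | yes p  | no ¬q  = contradiction (ℕₚ.<-≤-trans p x≤y) ¬q
... | no _   | yes _  = ℕₚ.m≤n⇒m≤1+n (rank-mono (k ∘ suc) x≤y)
... | no _   | no _   = rank-mono (k ∘ suc) x≤y

rank-suc-absent : ∀ {n} (k : Fin n → ℕ) {x} → (∀ u → k u ≢ x) → rank k (suc x) ≡ rank k x
rank-suc-absent {zero}  k absent = refl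
rank-suc-absent {suc n} k {x} absent with k zero <? suc x | k zero <? x
... | yes _  | yes _  = cong suc (rank-suc-absent (k ∘ suc) (absent ∘ suc))
... | yes p  | no ¬q  = contradiction (ℕₚ.≤∧≢⇒< (s≤s⁻¹ p) (absent zero)) ¬q
... | no ¬p  | yes q  = contradiction (ℕₚ.m<n⇒m<1+n q) ¬p
... | no _   | no _   = rank-suc-absent (k ∘ suc) (absent ∘ suc)

rank-suc : ∀ {n} {k : Fin n → ℕ} → Injective _≡_ _≡_ k →
           ∀ u → rank k (suc (k u)) ≡ suc (rank k (k u))
rank-suc {suc n} {k} k-injective zero with k zero <? suc (k zero) | k zero <? k zero
... | _      | yes p  = contradiction p (ℕₚ.<-irrefl refl)
... | no ¬p  | no _   = contradiction (ℕₚ.n<1+n (k zero)) ¬p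
... | yes _  | no _   = cong suc (rank-suc-absent (k ∘ suc) λ u e → 0≢1+n (k-injective (sym e)))
rank-suc {suc n} {k} k-injective (suc u) with k zero <? suc (k (suc u)) | k zero <? k (suc u)
... | yes _  | yes _  = cong suc (rank-suc (suc-injective ∘ k-injective) u)
... | yes p  | no ¬q  = contradiction (ℕₚ.≤∧≢⇒< (s≤s⁻¹ p) (0≢1+n ∘ k-injective)) ¬q
... | no ¬p  | yes q  = contradiction (ℕₚ.m<n⇒m<1+n q) ¬p
... | no _   | no _   = rank-suc (suc-injective ∘ k-injective) u

module Compression {n} {k : Fin n → ℕ} (k-injective : Injective _≡_ _≡_ k) where

  rank<n : ∀ u → rank k (k u) < n
  rank<n u = subst (_≤ n) (rank-suc k-injective u) (rank≤n k (suc (k u)))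

  rank-mono-< : ∀ {u v} → k u < k v → rank k (k u) < rank k (k v)
  rank-mono-< {u} ku<kv = subst (_≤ _) (rank-suc k-injective u) (rank-mono k ku<kv)

  rank-injective : Injective _≡_ _≡_ (rank k ∘ k)
  rank-injective {u} {v} eq with ℕₚ.<-cmp (k u) (k v)
  ... | tri< ku<kv _ _ = contradiction eq (ℕₚ.<⇒≢ (rank-mono-< ku<kv))
  ... | tri≈ _ ku≡kv _ = k-injective ku≡kv
  ... | tri> _ _ kv<ku = contradiction (sym eq) (ℕₚ.<⇒≢ (rank-mono-< kv<ku))

  compress : Fin n → Fin n
  compress u = fromℕ< (rank<n u)

  toℕ-compress : ∀ u → toℕ (compress u) ≡ rank k (k u)
  toℕ-compress u = toℕ-fromℕ< (rank<n u)

  compress-injective : Injective _≡_ _≡_ compress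
  compress-injective = rank-injective ∘ fromℕ<-injective _ _ (rank<n _) (rank<n _)

  compress-suc : ∀ {u v} → k v ≡ suc (k u) → toℕ (compress v) ≡ suc (toℕ (compress u))
  compress-suc {u} {v} kv≡1+ku = begin
    toℕ (compress v)          ≡⟨ toℕ-compress v ⟩
    rank k (k v)              ≡⟨ cong (rank k) kv≡1+ku ⟩
    rank k (suc (k u))        ≡⟨ rank-suc k-injective u ⟩
    suc (rank k (k u))        ≡⟨ cong suc (toℕ-compress u) ⟨
    suc (toℕ (compress u))    ∎
    where open ≡-Reasoning

module PathCover {n} (f : Map n) (D : Subset n)
  (kept-injective : ∀ i j → Kept f D i → Kept f D j → f i ≡ f j → i ≡ j)
  (acyclic : ∀ k (i : Fin n) → ¬ Walk f D (suc k) i i) where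

  kept? : ∀ i → Dec (Kept f D i)
  kept? i = ¬? (i ∈? D) ×-dec ¬? (f i ≟ᶠ i)

  vertexAt : ∀ {k u w} → Walk f D k u w → Fin (suc k) → Fin n
  vertexAt {u = u} _ zero    = u
  vertexAt (step _ p) (suc i) = vertexAt p i

  prefix : ∀ {k u w} (p : Walk f D k u w) j → Walk f D (toℕ j) u (vertexAt p j)
  prefix p          zero    = here
  prefix (step e p) (suc j) = step e (prefix p j)

  closedSubwalk : ∀ {k u w} (p : Walk f D k u w) {i j} → toℕ i < toℕ j →
                  vertexAt p i ≡ vertexAt p j → ∃ λ m → Walk f D (suc m) (vertexAt p j) (vertexAt p j)
  closedSubwalk p          {zero}  {suc j} _   eq =
    toℕ j , subst (λ u → Walk f D _ u (vertexAt p (suc j))) eq (prefix p (suc j))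
  closedSubwalk (step _ p) {suc i} {suc j} i<j eq = closedSubwalk p (s<s⁻¹ i<j) eq

  no-walk-of-length-n : ∀ {u w} → ¬ Walk f D n u w
  no-walk-of-length-n p with i , j , i<j , eq ← pigeonhole (ℕₚ.n<1+n n) (vertexAt p) =
    acyclic _ _ (proj₂ (closedSubwalk p i<j eq))

  follow : ℕ → Fin n → Fin n × ℕ
  follow zero    v = v , 0
  follow (suc k) v with kept? v
  ... | yes _ = map₂ suc (follow k (f v))
  ... | no  _ = v , 0

  follow-injective : ∀ k → Injective _≡_ _≡_ (follow k)
  follow-injective zero    eq = cong proj₁ eq
  follow-injective (suc k) {u} {v} eq with kept? u | kept? v
  ... | yes ku | yes kv = kept-injective u v ku kv (follow-injective k (cong (map₂ pred) eq))
  ... | yes _  | no _   = contradiction (cong proj₂ eq) ℕₚ.1+n≢0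
  ... | no _   | yes _  = contradiction (sym (cong proj₂ eq)) ℕₚ.1+n≢0
  ... | no _   | no _   = cong proj₁ eq

  follow-length≤ : ∀ k v → proj₂ (follow k v) ≤ k
  follow-length≤ zero    v = z≤n
  follow-length≤ (suc k) v with kept? v
  ... | yes _ = s≤s (follow-length≤ k (f v))
  ... | no  _ = z≤n

  follow-stable : ∀ k {v} → (∀ {w} → ¬ Walk f D k v w) → follow (suc k) v ≡ follow k v
  follow-stable zero    no-walk = contradiction here no-walk
  follow-stable (suc k) {v} no-walk with kept? v
  ... | yes kv = cong (map₂ suc) (follow-stable k (no-walk ∘ step kv))
  ... | no  _  = refl

  follow-kept : ∀ {v} → Kept f D v → follow (suc n) v ≡ map₂ suc (follow (suc n) (f v))
  follow-kept {v} kv with kept? v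
  ... | yes _  = cong (map₂ suc) (sym (follow-stable n no-walk-of-length-n))
  ... | no ¬kv = contradiction kv ¬kv

  pathEnd : Fin n → Fin n
  pathEnd v = proj₁ (follow (suc n) v)

  distanceToEnd : Fin n → ℕ
  distanceToEnd v = proj₂ (follow (suc n) v)

  distanceToEnd< : ∀ v → distanceToEnd v < suc (suc n)
  distanceToEnd< v = s≤s (follow-length≤ (suc n) v)

  key : Fin n → ℕ
  key v = suc (suc n) * toℕ (pathEnd v) + distanceToEnd v

  label : Fin n → Fin (n * suc (suc n))
  label v = combine (pathEnd v) (fromℕ< (distanceToEnd< v))

  toℕ-label : ∀ v → toℕ (label v) ≡ key v
  toℕ-label v = trans (toℕ-combine (pathEnd v) (fromℕ< (distanceToEnd< v)))
                      (cong (suc (suc n) * toℕ (pathEnd v) +_) (toℕ-fromℕ< (distanceToEnd< v)))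

  key-injective : Injective _≡_ _≡_ key
  key-injective {u} {v} eq = follow-injective (suc n) {u} {v} (×-≡,≡→≡ (end≡ , distance≡))
    where
    label≡ : label u ≡ label v
    label≡ = toℕ-injective (trans (toℕ-label u) (trans eq (sym (toℕ-label v))))
    end≡ : pathEnd u ≡ pathEnd v
    end≡ = proj₁ (combine-injective (pathEnd u) _ (pathEnd v) _ label≡)
    distance≡ : distanceToEnd u ≡ distanceToEnd v
    distance≡ = fromℕ<-injective _ _ (distanceToEnd< u) (distanceToEnd< v)
                  (proj₂ (combine-injective (pathEnd u) _ (pathEnd v) _ label≡))

  key-kept : ∀ {v} → Kept f D v → key v ≡ suc (key (f v))
  key-kept {v} kv = begin
    key v                                                           ≡⟨ cong keyOf (follow-kept kv) ⟩
    suc (suc n) * toℕ (pathEnd (f v)) + suc (distanceToEnd (f v))   ≡⟨ ℕₚ.+-suc _ _ ⟩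
    suc (key (f v))                                                 ∎
    where
    open ≡-Reasoning
    keyOf : Fin n × ℕ → ℕ
    keyOf (e , d) = suc (suc n) * toℕ e + d

  open Compression key-injective

  orderedByPaths : Σ (Permutation′ n) λ σ →
                   ∀ v → Kept f D v → toℕ (σ ⟨$⟩ʳ v) ≡ suc (toℕ (σ ⟨$⟩ʳ f v))
  orderedByPaths = proj₁ (injective⇒permutation compress-injective) ,
                   λ v kv → compress-suc {f v} {v} (key-kept kv)

numDiffs-positive : ∀ {m} (g : Map (suc m)) → 1 ≤ numDiffs g
numDiffs-positive g = s≤s z≤n

numDiffs≤length : ∀ {n} (g : Map n) (M : List ℕ) → (∀ i → ∣ toℕ (g i) - toℕ i ∣ ∈ₗ M) →
                  numDiffs g ≤ length M
numDiffs≤length {n} g M displacement∈M =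
  length-deduplicate≤ (map displacement (allFinL n)) λ z∈ →
    case ∈-map⁻ displacement z∈ of λ where (i , _ , refl) → displacement∈M i
  where
  displacement : Fin n → ℕ
  displacement i = ∣ toℕ (g i) - toℕ i ∣

fixedIndicator≡1 : ∀ {n} (f : Map n) {v} → f v ≡ v → fixedIndicator f ≡ 1
fixedIndicator≡1 f {v} fv≡v with any? (λ i → f i ≟ᶠ i)
... | yes _    = refl
... | no  ¬fix = contradiction (v , fv≡v) ¬fix

∣n-1+n∣≡1 : ∀ n → ∣ n - suc n ∣ ≡ 1
∣n-1+n∣≡1 n = trans (cong (∣ n -_∣) (ℕₚ.+-comm 1 n)) (ℕₚ.∣m-m+n∣≡n n 1)

module _ {n} (f : Map n) (D : Subset n) (σ : Permutation′ n)
  (consecutive : ∀ v → Kept f D v → toℕ (σ ⟨$⟩ʳ v) ≡ suc (toℕ (σ ⟨$⟩ʳ f v))) where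

  displacement : Fin n → ℕ
  displacement v = ∣ toℕ (σ ⟨$⟩ʳ f v) - toℕ (σ ⟨$⟩ʳ v) ∣

  displacements : List ℕ
  displacements = 1 ∷ subsetImage D displacement ++ replicate (fixedIndicator f) 0

  displacement-fixed : ∀ {v} → f v ≡ v → displacement v ≡ 0
  displacement-fixed {v} fv≡v =
    trans (cong (λ w → ∣ toℕ (σ ⟨$⟩ʳ w) - toℕ (σ ⟨$⟩ʳ v) ∣) fv≡v) (ℕₚ.∣n-n∣≡0 (toℕ (σ ⟨$⟩ʳ v)))

  displacement-kept : ∀ {v} → Kept f D v → displacement v ≡ 1
  displacement-kept {v} kv =
    trans (cong (∣ toℕ (σ ⟨$⟩ʳ f v) -_∣) (consecutive v kv)) (∣n-1+n∣≡1 (toℕ (σ ⟨$⟩ʳ f v)))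

  displacement∈ : ∀ v → displacement v ∈ₗ displacements
  displacement∈ v with v ∈? D | f v ≟ᶠ v
  ... | yes v∈D | _ = there (∈-++⁺ˡ (∈-subsetImage displacement v∈D))
  ... | no v∉D | yes fv≡v rewrite displacement-fixed fv≡v | fixedIndicator≡1 f fv≡v =
    there (∈-++⁺ʳ _ (here refl))
  ... | no v∉D | no fv≢v rewrite displacement-kept (v∉D , fv≢v) = here refl

  length-displacements : length displacements ≡ 1 + ∣ D ∣ + fixedIndicator f
  length-displacements = cong suc (trans (length-++ (subsetImage D displacement))
    (cong₂ _+_ (length-subsetImage D displacement) (length-replicate (fixedIndicator f))))

  numDiffs-conj≤ : numDiffs (conj σ f) ≤ 1 + ∣ D ∣ + fixedIndicator f
  numDiffs-conj≤ = subst (numDiffs (conj σ f) ≤_) length-displacements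
    (numDiffs≤length (conj σ f) displacements λ i →
      subst (λ j → ∣ toℕ (σ ⟨$⟩ʳ f (σ ⟨$⟩ˡ i)) - toℕ j ∣ ∈ₗ displacements) (inverseʳ σ)
            (displacement∈ (σ ⟨$⟩ˡ i)))

proposition14 : (n : ℕ) → 1 ≤ n → (f : Map n) → (μ ρ : ℕ)
    → IsMinDiffs f μ → IsRho f ρ
    → (1 ≤ μ) × (μ ≤ 1 + ρ + fixedIndicator f)
proposition14 (suc m) _ f _ _ ((σ₀ , refl) , μ-minimal) ((D , (_ , kept-injective , acyclic) , refl) , _) =
  let σ , consecutive = PathCover.orderedByPaths f D kept-injective acyclic
  in numDiffs-positive (conj σ₀ f) ,
     ℕₚ.≤-trans (μ-minimal _ (σ , refl)) (numDiffs-conj≤ f D σ consecutive)
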